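{- Let $G=(V,E)$ be a connected graph and $k,\delta\ge1$ integers. Algorithm 1 run with $\beta=3$ is an $O(\log_{\delta+1}k)$-approximation algorithm for BCMD-$\delta$: it returns a feasible augmentation (at most $k$ new edges, each vertex degree increased by at most $\delta$) whose resulting diameter is at most $O(\log_{\delta+1}k)\cdot D^*_{k,\delta}$.
   Context: Graphs are simple, undirected, unweighted; $d_G$ is shortest-path distance; distances between sets/families of vertices are minimum distances between their vertices. A $\beta$-segment is a set $C\subseteq V$ with $|C|=\beta$ whose induced subgraph $G[C]$ is connected. Problem BCMD-$\delta$: given $G$ and integers $k,\delta\ge1$, find a set $M$ of at most $k$ non-edges of $G$ minimizing the diameter of $G'=(V,E\cup M)$ subject to $\deg_{G'}(v)\le\deg_G(v)+\delta$ for all $v$; $D^*_{k,\delta}$ is its optimal value. Algorithm 1 (with parameter $\beta$): (i) compute a maximal family $\mathcal{C}$ of pairwise vertex-disjoint $\beta$-segments; (ii) starting from $\mathcal{X}=\emptyset$, repeat $\min\{k+1,|\mathcal{C}|\}$ times: add to $\mathcal{X}$ a segment $C^*\in\mathcal{C}\setminus\mathcal{X}$ maximizing $d_G(C^*,\mathcal{X})$ (the first arbitrary); (iii) connect the segments of $\mathcal{X}$, treated as supernodes, into a full tree with branching $d=\beta\delta$ using $|\mathcal{X}|-1$ new edges: the root segment's $\beta$ vertices are each joined to vertices of $\delta$ child segments; each non-root segment uses its remaining capacity so that each of its vertices gets at most $\delta$ new edges to new child segments; levels are filled completely before the next, so every vertex is incident to at most $\delta$ added edges. -}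

module Defs where

open import Data.Nat using (ℕ; zero; suc; _+_; _*_; _∸_; _≤_; _⊓_; _≤ᵇ_; _/_)
open import Data.Fin using (Fin; _≟_)
open import Data.Bool using (Bool; true; false; _∨_; _∧_; T; if_then_else_)
open import Data.List using (List; []; _∷_; length; map; take; concat; allFin)
open import Data.Nat.ListAction using (sum)
open import Data.Bool.ListAction using (any)
open import Data.List.Membership.Propositional using (_∈_; _∉_)
open import Data.List.Relation.Unary.All using (All)
open import Data.List.Relation.Unary.Any using (Any)
open import Data.List.Relation.Unary.AllPairs using (AllPairs)
open import Data.List.Relation.Unary.Unique.Propositional using (Unique)
open import Data.List.Relation.Binary.Permutation.Propositional using (_↭_)
open import Data.Product using (_×_; _,_; proj₁; proj₂; ∃; ∃₂; swap)
open import Data.Sum using (_⊎_)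
open import Relation.Nullary using (¬_; does)
open import Relation.Binary.PropositionalEquality using (_≡_; _≢_)

-- A graph on vertex set Fin n, given by a Boolean adjacency matrix.
-- (Simplicity = symmetry + irreflexivity is imposed as a hypothesis in the statement.)
BoolGraph : ℕ → Set
BoolGraph n = Fin n → Fin n → Bool

Adj : ∀ {n} → BoolGraph n → Fin n → Fin n → Set
Adj g u v = T (g u v)

data Walk {n : ℕ} (R : Fin n → Fin n → Set) : Fin n → Fin n → ℕ → Set where
  here : ∀ {u} → Walk R u u 0
  step : ∀ {u w v ℓ} → R u w → Walk R w v ℓ → Walk R u v (suc ℓ)

Within : ∀ {n} → (Fin n → Fin n → Set) → Fin n → Fin n → ℕ → Set
Within R u v d = ∃ λ ℓ → ℓ ≤ d × Walk R u v ℓ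

Connected : ∀ {n} → BoolGraph n → Set
Connected g = ∀ u v → ∃ λ ℓ → Walk (Adj g) u v ℓ

DiamLE : ∀ {n} → BoolGraph n → ℕ → Set
DiamLE g D = ∀ u v → Within (Adj g) u v D

deg : ∀ {n} → BoolGraph n → Fin n → ℕ
deg {n} g v = sum (map (λ u → if g v u then 1 else 0) (allFin n))

Edge : ℕ → Set
Edge n = Fin n × Fin n

hasEdge : ∀ {n} → List (Edge n) → Fin n → Fin n → Bool
hasEdge M u v = any (λ p → (does (proj₁ p ≟ u) ∧ does (proj₂ p ≟ v))
                         ∨ (does (proj₁ p ≟ v) ∧ does (proj₂ p ≟ u))) M

augment : ∀ {n} → BoolGraph n → List (Edge n) → BoolGraph n
augment g M u v = g u v ∨ hasEdge M u v

SameEdge : ∀ {n} → Edge n → Edge n → Set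
SameEdge p q = p ≡ q ⊎ p ≡ swap q

NonEdge : ∀ {n} → BoolGraph n → Edge n → Set
NonEdge g e = proj₁ e ≢ proj₂ e × g (proj₁ e) (proj₂ e) ≡ false

-- M is a feasible solution of BCMD-δ: a set of at most k non-edges
-- (listed without repetition as unordered pairs) with deg_{G'}(v) ≤ deg_G(v) + δ.
Feasible : ∀ {n} → BoolGraph n → ℕ → ℕ → List (Edge n) → Set
Feasible g k δ M =
  length M ≤ k × All (NonEdge g) M × AllPairs (λ p q → ¬ SameEdge p q) M
  × (∀ v → deg (augment g M) v ≤ deg g v + δ)

InducedConnected : ∀ {n} → BoolGraph n → List (Fin n) → Set
InducedConnected g C =
  ∀ {u v} → u ∈ C → v ∈ C → ∃ λ ℓ → Walk (λ a b → Adj g a b × a ∈ C × b ∈ C) u v ℓ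

Segment : ∀ {n} → BoolGraph n → ℕ → List (Fin n) → Set
Segment g β C = length C ≡ β × Unique C × InducedConnected g C

Disjoint : ∀ {n} → List (Fin n) → List (Fin n) → Set
Disjoint C D = ∀ {v} → v ∈ C → v ∉ D

MaximalSegmentFamily : ∀ {n} → BoolGraph n → ℕ → List (List (Fin n)) → Set
MaximalSegmentFamily g β 𝒞 =
  All (Segment g β) 𝒞 × AllPairs Disjoint 𝒞
  × (∀ S → Segment g β S → Any (λ C → ∃ λ v → v ∈ S × v ∈ C) 𝒞)

SetWithin : ∀ {n} → BoolGraph n → List (Fin n) → List (Fin n) → ℕ → Set
SetWithin g A B d = ∃₂ λ u v → u ∈ A × v ∈ B × Within (Adj g) u v d

data At {A : Set} : List A → ℕ → A → Set where
  at0 : ∀ {x xs} → At (x ∷ xs) 0 x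
  atS : ∀ {x y xs i} → At xs i y → At (x ∷ xs) (suc i) y

-- X (in selection order) is produced by farthest-first selection from 𝒞:
-- the j-th chosen segment maximises d_G(C, 𝒳) over C ∈ 𝒞 ∖ 𝒳, 𝒳 = first j choices.
-- (d(C,𝒳) ≤ d(Cj,𝒳) is expressed as: ∀ d, d(Cj,𝒳) ≤ d → d(C,𝒳) ≤ d.)
FarthestFirst : ∀ {n} → BoolGraph n → List (List (Fin n)) → List (List (Fin n)) → Set
FarthestFirst g 𝒞 X =
  ∀ j Cj → At X j Cj → ∀ C → C ∈ 𝒞 → C ∉ take j X →
    ∀ d → SetWithin g Cj (concat (take j X)) d → SetWithin g C (concat (take j X)) d

-- Parent of position i ≥ 1 in the full tree, positions numbered level by level
-- (BFS order): the root (position 0) has d = βδ children, every other node d-1.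
treeParent : ℕ → ℕ → ℕ → ℕ
treeParent β δ i =
  if i ≤ᵇ β * δ then 0 else suc ((i ∸ β * δ ∸ 1) / suc (β * δ ∸ 2))

incident : ∀ {n} → List (Edge n) → Fin n → ℕ
incident M v = sum (map (λ e → if does (v ≟ proj₁ e) ∨ does (v ≟ proj₂ e) then 1 else 0) M)

-- Step (iii): segments of X arranged as the nodes T of the full tree (BFS order);
-- the i-th new edge joins a vertex of the node at position i+1 to a vertex of
-- its parent; new edges are non-edges of G; each vertex gets ≤ δ new edges.
TreeConnect : ∀ {n} → BoolGraph n → ℕ → ℕ → List (List (Fin n)) → List (Edge n) → Set
TreeConnect g β δ X M =
  ∃ λ T → T ↭ X × length M ≡ length X ∸ 1 × All (NonEdge g) M
  × (∀ i e C P → At M i e → At T (suc i) C → At T (treeParent β δ (suc i)) P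
       → proj₁ e ∈ C × proj₂ e ∈ P)
  × (∀ v → incident M v ≤ δ)

Alg1Run : ∀ {n} → BoolGraph n → ℕ → ℕ → ℕ → List (Edge n) → Set
Alg1Run g β k δ M =
  ∃₂ λ 𝒞 X → MaximalSegmentFamily g β 𝒞
    × All (_∈ 𝒞) X × Unique X × length X ≡ suc k ⊓ length 𝒞
    × FarthestFirst g 𝒞 X × TreeConnect g β δ X M

{-# OPTIONS --safe #-}
-- Fix a competing augmentation M′ with |M′| ≤ k and diam (G + M′) ≤ D. Vertices that are pairwise
-- more than 2D apart in G number at most |M′| + 1: label each vertex by the last added edge on a
-- shortest walk to it from a fixed root (0 if there is none); by shortestness, two vertices with the
-- same label j are both within D in G of the endpoint of edge j that is farther from the root.
-- Hence the k + 1 segments picked farthest-first leave no segment of the maximal family more than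
-- 2D away, and by maximality every vertex not adjacent to all others is within 4 + 2D of a picked
-- segment. Picked segments have diameter at most 2 and hang in a tree in which every non-root node
-- has at least δ + 1 children; with at most k + 1 ≤ (δ + 1)^t + 1 nodes, each one is within 3t + 5
-- of the root segment in G + M. So diam (G + M) ≤ 2 (4 + 2D + 3t + 5) ≤ 28 (t + 1) D.
-- Feasibility is read off the tree: its edges join distinct child segments to their parents.
module Submission where

open import Defs
open import Data.Nat using (ℕ; suc; _*_; _≤_; _^_)
open import Data.Fin using (Fin)
open import Data.List using (List)
open import Data.Product using (_×_; ∃)
open import Relation.Binary.PropositionalEquality using (_≡_)
open import Data.Bool using (false)

open import Data.Nat using (zero; _+_; _∸_; _<_; _⊓_; _≤ᵇ_; _/_; z≤n; s≤s)
open import Data.Nat.Properties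
  using (≤-refl; ≤-reflexive; ≤-trans; ≤-total; ≤-pred; <-trans; <-irrefl; <-asym; <⇒≱; ≰⇒>; 1+n≰n;
         suc-injective; ≤ᵇ⇒≤; ≤⇒≤ᵇ; module ≤-Reasoning; +-suc; +-mono-≤; +-monoʳ-≤; m≤m+n; m≤n+m;
         n≤1+n; *-comm; *-suc; m≤n*m; ^-monoˡ-≤; m∸n≤m; ∸-monoˡ-≤; ∸-monoˡ-<; m+n≤o⇒m≤o∸n; ⊓-sel; m⊓n≤m)
open import Data.Nat.DivMod using (m/n≤m; m<n*o⇒m/o<n)
open import Data.Nat.Tactic.RingSolver using (solve-∀)
open import Data.Nat.ListAction using (sum)
open import Data.Fin as Fin using (_≟_)
open import Data.Fin.Properties as Finₚ using (injective⇒≤)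
open import Data.Bool using (Bool; true; T; _∨_; _∧_; if_then_else_)
open import Data.Bool.Properties using (T-∨; T-∧; ∨-comm)
open import Data.List using ([]; _∷_; length; map; take; concat; allFin; lookup; upTo)
open import Data.List.Properties using (length-map; length-upTo)
open import Data.List.Membership.Propositional using (_∈_; _∉_; find; lose)
open import Data.List.Membership.Propositional.Properties
  using (∈-lookup; ∈-map⁻; ∈-upTo⁺; ∈-concat⁺′; ∈-concat⁻′)
open import Data.List.Relation.Binary.Subset.Propositional using (_⊆_)
open import Data.List.Relation.Unary.All as All using (All; []; _∷_)
import Data.List.Relation.Unary.All.Properties as All
open import Data.List.Relation.Unary.Any as Any using (Any; here; there)
open import Data.List.Relation.Unary.Any.Properties using (lookup-index; any⁺; any⁻)
open import Data.List.Relation.Unary.AllPairs as AllPairs using (AllPairs; []; _∷_)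
import Data.List.Relation.Unary.AllPairs.Properties as AllPairs
open import Data.List.Relation.Unary.Unique.Propositional using (Unique)
open import Data.List.Relation.Unary.Unique.Propositional.Properties using (allFin⁺)
open import Data.List.Relation.Binary.Permutation.Propositional using (_↭_; ↭-sym; ↭⇒↭ₛ)
open import Data.List.Relation.Binary.Permutation.Propositional.Properties
  using (All-resp-↭; ∈-resp-↭; ↭-length)
import Data.List.Relation.Binary.Permutation.Setoid.Properties as Permutationₛ
open import Data.Product using (_,_; proj₁; proj₂; ∃₂)
open import Data.Sum using (_⊎_; inj₁; inj₂)
open import Data.Empty using (⊥; ⊥-elim)
open import Data.Unit using (tt)
open import Function using (_∘_)
open import Level using (0ℓ)
open import Function.Bundles using (Equivalence)
open import Function.Definitions using (Injective)
open import Relation.Binary using (Rel; Symmetric; Decidable; _⇒_; tri<; tri≈; tri>)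
open import Relation.Binary.PropositionalEquality
  using (refl; sym; trans; cong; cong₂; subst; _≢_; setoid; resp₂; module ≡-Reasoning)
open import Relation.Nullary using (¬_; Dec; yes; no; does; contradiction; ¬?; _×-dec_)
open import Relation.Nullary.Decidable using (T?; decidable-stable; map′; _⊎-dec_)

module _ {A : Set} where

  At⇒∈ : ∀ {xs i} {x : A} → At xs i x → x ∈ xs
  At⇒∈ at0 = here refl
  At⇒∈ (atS p) = there (At⇒∈ p)

  ∈⇒At : ∀ {xs} {x : A} → x ∈ xs → ∃ λ i → At xs i x
  ∈⇒At (here refl) = 0 , at0
  ∈⇒At (there p) = let i , q = ∈⇒At p in suc i , atS q

  At-functional : ∀ {xs i} {x y : A} → At xs i x → At xs i y → x ≡ y
  At-functional at0 at0 = refl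
  At-functional (atS p) (atS q) = At-functional p q

  At⇒< : ∀ {xs i} {x : A} → At xs i x → i < length xs
  At⇒< at0 = s≤s z≤n
  At⇒< (atS p) = s≤s (At⇒< p)

  <⇒At : ∀ (xs : List A) {i} → i < length xs → ∃ λ x → At xs i x
  <⇒At (x ∷ xs) {zero} _ = x , at0
  <⇒At (x ∷ xs) {suc i} (s≤s i<) = let y , p = <⇒At xs i< in y , atS p

  All-At : ∀ {P : A → Set} {xs i x} → All P xs → At xs i x → P x
  All-At (px ∷ _) at0 = px
  All-At (_ ∷ pxs) (atS p) = All-At pxs p

  At-map⁻ : ∀ {B : Set} (f : A → B) {xs i y} → At (map f xs) i y → ∃ λ x → At xs i x × y ≡ f x
  At-map⁻ f {x ∷ xs} at0 = x , at0 , refl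
  At-map⁻ f {x ∷ xs} (atS p) = let z , q , eq = At-map⁻ f p in z , atS q , eq

  At⇒∈take : ∀ {xs i j} {x : A} → At xs i x → i < j → x ∈ take j xs
  At⇒∈take at0 (s≤s _) = here refl
  At⇒∈take (atS p) (s≤s i<j) = there (At⇒∈take p i<j)

  ∈take⇒∈ : ∀ (xs : List A) j {x} → x ∈ take j xs → x ∈ xs
  ∈take⇒∈ (y ∷ xs) (suc j) (here eq) = here eq
  ∈take⇒∈ (y ∷ xs) (suc j) (there p) = there (∈take⇒∈ xs j p)

  AllPairs-fromAt : ∀ {R : Rel A 0ℓ} xs → (∀ {i j x y} → i < j → At xs i x → At xs j y → R x y) →
                    AllPairs R xs
  AllPairs-fromAt [] h = []
  AllPairs-fromAt (x ∷ xs) h =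
    All.tabulate (λ y∈ → h (s≤s z≤n) at0 (atS (proj₂ (∈⇒At y∈))))
    ∷ AllPairs-fromAt xs (λ i<j p q → h (s≤s i<j) (atS p) (atS q))

  AllPairs-lookup : ∀ {R : Rel A 0ℓ} {xs} → AllPairs R xs → ∀ {i j} → i Fin.< j → R (lookup xs i) (lookup xs j)
  AllPairs-lookup (r ∷ _) {Fin.zero} {Fin.suc j} _ = All.lookup r (∈-lookup j)
  AllPairs-lookup (_ ∷ rs) {Fin.suc i} {Fin.suc j} (s≤s i<j) = AllPairs-lookup rs i<j

  Unique⇒lookup-injective : ∀ {xs} → Unique xs → Injective _≡_ _≡_ (lookup xs)
  Unique⇒lookup-injective u {i} {j} eq with Finₚ.<-cmp i j
  ... | tri< i<j _ _ = contradiction eq (AllPairs-lookup u i<j)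
  ... | tri≈ _ i≡j _ = i≡j
  ... | tri> _ _ j<i = contradiction (sym eq) (AllPairs-lookup u j<i)

  Unique-⊆⇒length≤ : ∀ {xs ys : List A} → Unique xs → xs ⊆ ys → length xs ≤ length ys
  Unique-⊆⇒length≤ {xs} {ys} u xs⊆ys = injective⇒≤ index-injective
    where
    index : Fin (length xs) → Fin (length ys)
    index i = Any.index (xs⊆ys (∈-lookup i))
    index-injective : Injective _≡_ _≡_ index
    index-injective {i} {j} eq = Unique⇒lookup-injective u (begin
      lookup xs i                 ≡⟨ lookup-index (xs⊆ys (∈-lookup i)) ⟩
      lookup ys (index i)         ≡⟨ cong (lookup ys) eq ⟩
      lookup ys (index j)         ≡⟨ lookup-index (xs⊆ys (∈-lookup j)) ⟨
      lookup xs j                 ∎)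
      where open ≡-Reasoning

AllPairs-∈ : ∀ {A : Set} {R : Rel A 0ℓ} → Symmetric R → ∀ {ys} → AllPairs R ys →
             ∀ {a b} → a ∈ ys → b ∈ ys → a ≢ b → R a b
AllPairs-∈ R-sym (_ ∷ _) (here refl) (here refl) a≢b = contradiction refl a≢b
AllPairs-∈ R-sym (r ∷ _) (here refl) (there b∈) _ = All.lookup r b∈
AllPairs-∈ R-sym (r ∷ _) (there a∈) (here refl) _ = R-sym (All.lookup r a∈)
AllPairs-∈ R-sym (_ ∷ rs) (there a∈) (there b∈) a≢b = AllPairs-∈ R-sym rs a∈ b∈ a≢b

AllPairs-⊆ : ∀ {A : Set} {R : Rel A 0ℓ} → Symmetric R → ∀ {xs ys} → AllPairs R ys → Unique xs → All (_∈ ys) xs →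
             AllPairs R xs
AllPairs-⊆ R-sym rs [] [] = []
AllPairs-⊆ R-sym rs (x∉ ∷ u) (x∈ ∷ xs⊆) =
  All.zipWith (λ (x≢y , y∈) → AllPairs-∈ R-sym rs x∈ y∈ x≢y) (x∉ , xs⊆) ∷ AllPairs-⊆ R-sym rs u xs⊆

least-witness : ∀ {P : ℕ → Set} → (∀ l → Dec (P l)) → ∀ {d} → P d →
                ∃ λ L → L ≤ d × P L × (∀ {l} → l < L → ¬ P l)
least-witness P? {d} pd with P? 0
... | yes p0 = 0 , z≤n , p0 , λ ()
least-witness P? {zero} pd | no ¬p0 = contradiction pd ¬p0
least-witness P? {suc d} pd | no ¬p0 =
  let L , L≤d , pL , below = least-witness (P? ∘ suc) pd
  in suc L , s≤s L≤d , pL , λ { {zero} _ → ¬p0 ; {suc l} (s≤s l<L) → below l<L }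

module _ {n : ℕ} {R : Fin n → Fin n → Set} where

  Walk-++ : ∀ {u w v a b} → Walk R u w a → Walk R w v b → Walk R u v (a + b)
  Walk-++ here q = q
  Walk-++ (step r p) q = step r (Walk-++ p q)

  Walk-snoc : ∀ {u w v ℓ} → Walk R u w ℓ → R w v → Walk R u v (suc ℓ)
  Walk-snoc here r = step r here
  Walk-snoc (step r′ p) r = step r′ (Walk-snoc p r)

  Walk-reverse : Symmetric R → ∀ {u v ℓ} → Walk R u v ℓ → Walk R v u ℓ
  Walk-reverse R-sym here = here
  Walk-reverse R-sym (step r p) = Walk-snoc (Walk-reverse R-sym p) (R-sym r)

  Within-refl : ∀ {u d} → Within R u u d
  Within-refl = 0 , z≤n , here

  Within-edge : ∀ {u v d} → R u v → Within R u v (suc d)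
  Within-edge r = 1 , s≤s z≤n , step r here

  Within-trans : ∀ {u w v a b} → Within R u w a → Within R w v b → Within R u v (a + b)
  Within-trans (ℓ₁ , ℓ₁≤ , p) (ℓ₂ , ℓ₂≤ , q) = ℓ₁ + ℓ₂ , +-mono-≤ ℓ₁≤ ℓ₂≤ , Walk-++ p q

  Within-mono : ∀ {u v a b} → a ≤ b → Within R u v a → Within R u v b
  Within-mono a≤b (ℓ , ℓ≤a , p) = ℓ , ≤-trans ℓ≤a a≤b , p

  Within-sym : Symmetric R → ∀ {u v d} → Within R u v d → Within R v u d
  Within-sym R-sym (ℓ , ℓ≤ , p) = ℓ , ℓ≤ , Walk-reverse R-sym p

  within? : Decidable R → ∀ d u v → Dec (Within R u v d)
  within? R? d u v with u ≟ v
  ... | yes refl = yes Within-refl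
  within? R? zero u v | no u≢v = no λ { (.0 , z≤n , here) → u≢v refl }
  within? R? (suc d) u v | no u≢v =
    map′ (λ (w , r , (ℓ , ℓ≤ , p)) → suc ℓ , s≤s ℓ≤ , step r p) from
         (Finₚ.any? (λ w → R? u w ×-dec within? R? d w v))
    where
    from : Within R u v (suc d) → ∃ λ w → R u w × Within R w v d
    from (.0 , _ , here) = contradiction refl u≢v
    from (suc ℓ , s≤s ℓ≤ , step r p) = _ , r , ℓ , ℓ≤ , p

  Walk-exit : (P : Fin n → Set) → (∀ w → Dec (P w)) → ∀ {u v ℓ} → P u → ¬ P v → Walk R u v ℓ →
              ∃₂ λ a b → P a × ¬ P b × R a b
  Walk-exit P P? pu ¬pv here = contradiction pu ¬pv
  Walk-exit P P? pu ¬pv (step {w = w} r p) with P? w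
  ... | yes pw = Walk-exit P P? pw ¬pv p
  ... | no ¬pw = _ , w , pu , ¬pw , r

Within-positive : ∀ {n} {R : Fin n → Fin n → Set} {u v d} → u ≢ v → Within R u v d → 1 ≤ d
Within-positive u≢v (.0 , _ , here) = contradiction refl u≢v
Within-positive u≢v (suc ℓ , 1+ℓ≤d , _) = ≤-trans (s≤s z≤n) 1+ℓ≤d

module _ {n : ℕ} {R S : Fin n → Fin n → Set} (R⇒S : R ⇒ S) where

  Walk-map : ∀ {u v ℓ} → Walk R u v ℓ → Walk S u v ℓ
  Walk-map here = here
  Walk-map (step r p) = step (R⇒S r) (Walk-map p)

  Within-map : ∀ {u v d} → Within R u v d → Within S u v d
  Within-map (ℓ , ℓ≤ , p) = ℓ , ℓ≤ , Walk-map p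

module _ {n : ℕ} (g : BoolGraph n) where

  Adj? : Decidable (Adj g)
  Adj? u v = T? (g u v)

  Adj-sym : (∀ u v → g u v ≡ g v u) → Symmetric (Adj g)
  Adj-sym g-sym {u} {v} = subst T (g-sym u v)

  Adj-irrefl : (∀ u → g u u ≡ false) → ∀ {u v} → Adj g u v → u ≢ v
  Adj-irrefl g-irrefl {u} a refl = subst T (g-irrefl u) a

T-does⁻ : ∀ {A : Set} (a? : Dec A) → T (does a?) → A
T-does⁻ (yes a) _ = a

T-does⁺ : ∀ {A : Set} (a? : Dec A) → A → T (does a?)
T-does⁺ (yes _) _ = tt
T-does⁺ (no ¬a) a = ¬a a

joins : ∀ {n} → Fin n → Fin n → Edge n → Bool
joins u v e = (does (proj₁ e ≟ u) ∧ does (proj₂ e ≟ v)) ∨ (does (proj₁ e ≟ v) ∧ does (proj₂ e ≟ u))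

joins⁻ : ∀ {n} {u v : Fin n} e → T (joins u v e) → (proj₁ e ≡ u × proj₂ e ≡ v) ⊎ (proj₁ e ≡ v × proj₂ e ≡ u)
joins⁻ {u = u} {v} (a , b) t with Equivalence.to (T-∨ {does (a ≟ u) ∧ does (b ≟ v)}) t
... | inj₁ forward = let a≟u , b≟v = Equivalence.to T-∧ forward in inj₁ (T-does⁻ (a ≟ u) a≟u , T-does⁻ (b ≟ v) b≟v)
... | inj₂ backward = let a≟v , b≟u = Equivalence.to T-∧ backward in inj₂ (T-does⁻ (a ≟ v) a≟v , T-does⁻ (b ≟ u) b≟u)

module _ {n : ℕ} (g : BoolGraph n) (M : List (Edge n)) where

  Adj⇒Adj-augment : Adj g ⇒ Adj (augment g M)
  Adj⇒Adj-augment a = Equivalence.from T-∨ (inj₁ a)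

  Within-augment : ∀ {u v d} → Within (Adj g) u v d → Within (Adj (augment g M)) u v d
  Within-augment = Within-map {R = Adj g} Adj⇒Adj-augment

  ∈⇒Adj-augment : ∀ {e} → e ∈ M → Adj (augment g M) (proj₁ e) (proj₂ e)
  ∈⇒Adj-augment e∈M = Equivalence.from T-∨ (inj₂ (any⁺ (joins _ _) (Any.map joins-itself e∈M)))
    where
    joins-itself : ∀ {e e′} → e ≡ e′ → T (joins (proj₁ e) (proj₂ e) e′)
    joins-itself {e} refl = Equivalence.from T-∨ (inj₁ (Equivalence.from T-∧
      (T-does⁺ (proj₁ e ≟ proj₁ e) refl , T-does⁺ (proj₂ e ≟ proj₂ e) refl)))

  Adj-augment⁻ : ∀ {u v} → Adj (augment g M) u v →
                 Adj g u v ⊎ ∃₂ λ j e → At M j e × SameEdge (u , v) e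
  Adj-augment⁻ {u} {v} a with Equivalence.to (T-∨ {g u v}) a
  ... | inj₁ a-g = inj₁ a-g
  ... | inj₂ a-M with find (any⁻ (joins u v) M a-M)
  ...   | e , e∈M , t with ∈⇒At e∈M | joins⁻ e t
  ...     | j , at | inj₁ (refl , refl) = inj₂ (j , e , at , inj₁ refl)
  ...     | j , at | inj₂ (refl , refl) = inj₂ (j , e , at , inj₂ refl)

hasEdge-sym : ∀ {n} (M : List (Edge n)) u v → hasEdge M u v ≡ hasEdge M v u
hasEdge-sym [] u v = refl
hasEdge-sym ((a , b) ∷ M) u v =
  cong₂ _∨_ (∨-comm (does (a ≟ u) ∧ does (b ≟ v)) (does (a ≟ v) ∧ does (b ≟ u))) (hasEdge-sym M u v)

augment-sym : ∀ {n} {g : BoolGraph n} (M : List (Edge n)) → (∀ u v → g u v ≡ g v u) →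
              ∀ u v → augment g M u v ≡ augment g M v u
augment-sym M g-sym u v = cong₂ _∨_ (g-sym u v) (hasEdge-sym M u v)

count : ∀ {A : Set} → (A → Bool) → List A → ℕ
count f xs = sum (map (λ x → if f x then 1 else 0) xs)

module _ {A : Set} where

  count-∨ : ∀ (f h : A → Bool) xs → count (λ x → f x ∨ h x) xs ≤ count f xs + count h xs
  count-∨ f h [] = z≤n
  count-∨ f h (x ∷ xs) with f x | h x | count-∨ f h xs
  ... | true  | true  | ih = s≤s (≤-trans ih (+-monoʳ-≤ (count f xs) (n≤1+n _)))
  ... | true  | false | ih = s≤s ih
  ... | false | true  | ih = ≤-trans (s≤s ih) (≤-reflexive (sym (+-suc (count f xs) (count h xs))))
  ... | false | false | ih = ih

  count-none : ∀ (f : A → Bool) {xs} → All (λ x → ¬ T (f x)) xs → count f xs ≡ 0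
  count-none f [] = refl
  count-none f {x ∷ xs} (¬fx ∷ ¬fxs) with f x
  ... | true = contradiction tt ¬fx
  ... | false = count-none f ¬fxs

  count-≤1 : ∀ (f : A → Bool) {xs c} → Unique xs → (∀ {x} → T (f x) → x ≡ c) → count f xs ≤ 1
  count-≤1 f [] only-c = z≤n
  count-≤1 f {x ∷ xs} (x∉xs ∷ u) only-c with f x in fx
  ... | true  = s≤s (≤-reflexive (count-none f (All.map x≢⇒¬f x∉xs)))
    where
    x≢⇒¬f : ∀ {y} → x ≢ y → ¬ T (f y)
    x≢⇒¬f x≢y fy = x≢y (trans (only-c (subst T (sym fx) tt)) (sym (only-c fy)))
  ... | false = count-≤1 f u only-c

count-joins≤ : ∀ {n} (e : Edge n) v → proj₁ e ≢ proj₂ e →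
               count (λ u → joins v u e) (allFin n) ≤ (if does (v ≟ proj₁ e) ∨ does (v ≟ proj₂ e) then 1 else 0)
count-joins≤ {n} (a , b) v a≢b with v ≟ a | v ≟ b
... | yes refl | _ = count-≤1 (λ u → joins v u (a , b)) (allFin⁺ n) only-b
  where
  only-b : ∀ {u} → T (joins v u (a , b)) → u ≡ b
  only-b t with joins⁻ (a , b) t
  ... | inj₁ (_ , refl) = refl
  ... | inj₂ (refl , b≡a) = contradiction (sym b≡a) a≢b
... | no _ | yes refl = count-≤1 (λ u → joins v u (a , b)) (allFin⁺ n) only-a
  where
  only-a : ∀ {u} → T (joins v u (a , b)) → u ≡ a
  only-a t with joins⁻ (a , b) t
  ... | inj₁ (a≡b , _) = contradiction a≡b a≢b
  ... | inj₂ (refl , _) = refl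
... | no v≢a | no v≢b = ≤-reflexive (count-none (λ u → joins v u (a , b)) {allFin n} (All.tabulate (λ _ → no-joins)))
  where
  no-joins : ∀ {u} → ¬ T (joins v u (a , b))
  no-joins t with joins⁻ (a , b) t
  ... | inj₁ (a≡v , _) = v≢a (sym a≡v)
  ... | inj₂ (_ , b≡v) = v≢b (sym b≡v)

count-hasEdge≤incident : ∀ {n} (M : List (Edge n)) v → All (λ e → proj₁ e ≢ proj₂ e) M →
                         count (hasEdge M v) (allFin n) ≤ incident M v
count-hasEdge≤incident {n} [] v [] = ≤-reflexive (count-none (λ _ → false) {allFin n} (All.tabulate (λ _ ())))
count-hasEdge≤incident {n} (e ∷ M) v (e-loopless ∷ M-loopless) =
  ≤-trans (count-∨ (λ u → joins v u e) (hasEdge M v) (allFin n))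
          (+-mono-≤ (count-joins≤ e v e-loopless) (count-hasEdge≤incident M v M-loopless))

deg-augment≤ : ∀ {n} (g : BoolGraph n) (M : List (Edge n)) → All (λ e → proj₁ e ≢ proj₂ e) M →
               ∀ v → deg (augment g M) v ≤ deg g v + incident M v
deg-augment≤ {n} g M M-loopless v =
  ≤-trans (count-∨ (g v) (hasEdge M v) (allFin n)) (+-monoʳ-≤ (deg g v) (count-hasEdge≤incident M v M-loopless))

-- Vertices far apart in G, against a competing augmentation

module Signatures {n} (g : BoolGraph n) (g-sym : ∀ u v → g u v ≡ g v u)
                  (M : List (Edge n)) {D} (diam : DiamLE (augment g M) D) (r : Fin n) where

  G G′ : Fin n → Fin n → Set
  G = Adj g
  G′ = Adj (augment g M)

  G-sym : Symmetric G
  G-sym = Adj-sym g g-sym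

  data LastAdded (u v : Fin n) (ℓ : ℕ) : Set where
    noneAdded : Walk G u v ℓ → LastAdded u v ℓ
    lastAddedAt : ∀ {a b ℓ₁ ℓ₂ j e} → At M j e → SameEdge (a , b) e →
                  Walk G′ u a ℓ₁ → Walk G b v ℓ₂ → suc (ℓ₁ + ℓ₂) ≡ ℓ → LastAdded u v ℓ

  lastAdded : ∀ {u v ℓ} → Walk G′ u v ℓ → LastAdded u v ℓ
  lastAdded here = noneAdded here
  lastAdded (step a p) with lastAdded p | Adj-augment⁻ g M a
  ... | noneAdded q | inj₁ a-g = noneAdded (step a-g q)
  ... | noneAdded q | inj₂ (j , e , at , ab≈e) = lastAddedAt at ab≈e here q refl
  ... | lastAddedAt at ab≈e pre q len | _ = lastAddedAt at ab≈e (step a pre) q (cong suc len)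

  data Signature (p : Fin n) : ℕ → Set where
    viaG : Within G r p D → Signature p 0
    viaAdded : ∀ {a b ℓ j e} → At M j e → SameEdge (a , b) e →
               Within G′ r a ℓ → ¬ Within G′ r b ℓ → Within G b p D → Signature p (suc j)

  signature : ∀ p → ∃ (Signature p)
  signature p with least-witness (λ l → within? (Adj? (augment g M)) l r p) (diam r p)
  ... | L , L≤D , (ℓ , ℓ≤L , w) , shorter-fails with lastAdded w
  ... | noneAdded q = 0 , viaG (ℓ , ≤-trans ℓ≤L L≤D , q)
  ... | lastAddedAt {b = b} {ℓ₁} {ℓ₂} {j} at ab≈e pre q refl =
          suc j , viaAdded at ab≈e (ℓ₁ , ≤-refl , pre) b-farther (ℓ₂ , ℓ₂≤D , q)
    where
    b-farther : ¬ Within G′ r b ℓ₁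
    b-farther rb = shorter-fails ℓ≤L
                     (Within-trans rb (Within-augment g M (ℓ₂ , ≤-refl , q)))
    ℓ₂≤D : ℓ₂ ≤ D
    ℓ₂≤D = ≤-trans (≤-trans (m≤n+m ℓ₂ ℓ₁) (n≤1+n _)) (≤-trans ℓ≤L L≤D)

  signature< : ∀ p → proj₁ (signature p) < suc (length M)
  signature< p with signature p
  ... | _ , viaG _ = s≤s z≤n
  ... | _ , viaAdded at _ _ _ _ = s≤s (At⇒< at)

  crossed-orientations : ∀ {a b ℓ ℓ′} → Within G′ r a ℓ → ¬ Within G′ r b ℓ →
                         Within G′ r b ℓ′ → ¬ Within G′ r a ℓ′ → ⊥
  crossed-orientations ra ¬rb rb ¬ra with ≤-total _ _
  ... | inj₁ ℓ≤ℓ′ = ¬ra (Within-mono ℓ≤ℓ′ ra)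
  ... | inj₂ ℓ′≤ℓ = ¬rb (Within-mono ℓ′≤ℓ rb)

  sameSignature⇒within : ∀ {p q c} → Signature p c → Signature q c → Within G p q (D + D)
  sameSignature⇒within (viaG rp) (viaG rq) = Within-trans (Within-sym G-sym rp) rq
  sameSignature⇒within (viaAdded at ab≈e ra ¬rb bp) (viaAdded at′ ab≈e′ ra′ ¬rb′ bq)
    with At-functional at at′
  ... | refl with ab≈e | ab≈e′
  ...   | inj₁ refl | inj₁ refl = Within-trans (Within-sym G-sym bp) bq
  ...   | inj₂ refl | inj₂ refl = Within-trans (Within-sym G-sym bp) bq
  ...   | inj₁ refl | inj₂ refl = ⊥-elim (crossed-orientations ra ¬rb ra′ ¬rb′)
  ...   | inj₂ refl | inj₁ refl = ⊥-elim (crossed-orientations ra ¬rb ra′ ¬rb′)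

farPoints-length≤ : ∀ {n} (g : BoolGraph n) → (∀ u v → g u v ≡ g v u) →
                    ∀ {M D} → DiamLE (augment g M) D →
                    ∀ {ps} → AllPairs (λ x y → ¬ Within (Adj g) x y (D + D)) ps → length ps ≤ suc (length M)
farPoints-length≤ g g-sym diam {[]} _ = z≤n
farPoints-length≤ g g-sym {M} {D} diam {ps@(r ∷ _)} far = begin
  length ps                       ≡⟨ length-map sig ps ⟨
  length (map sig ps)             ≤⟨ Unique-⊆⇒length≤ sigs-unique sigs-bounded ⟩
  length (upTo (suc (length M)))  ≡⟨ length-upTo _ ⟩
  suc (length M)                  ∎
  where
  open Signatures g g-sym M diam r
  open ≤-Reasoning
  sig : Fin _ → ℕ
  sig p = proj₁ (signature p)
  sameSig⇒within : ∀ x y → sig x ≡ sig y → Within G x y (D + D)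
  sameSig⇒within x y eq with signature x | signature y
  ... | c , sx | c′ , sy = sameSignature⇒within sx (subst (Signature y) (sym eq) sy)
  sigs-unique : Unique (map sig ps)
  sigs-unique = AllPairs.map⁺ (AllPairs.map (λ {x} {y} far-xy eq → far-xy (sameSig⇒within x y eq)) far)
  sigs-bounded : map sig ps ⊆ upTo (suc (length M))
  sigs-bounded s∈ with ∈-map⁻ sig s∈
  ... | p , _ , refl = ∈-upTo⁺ (signature< p)

-- 3-segments

InducedAdj : ∀ {n} → BoolGraph n → List (Fin n) → Fin n → Fin n → Set
InducedAdj g S a b = Adj g a b × a ∈ S × b ∈ S

no-four-in-three : ∀ {A : Set} {S : List A} → length S ≡ 3 →
                   ∀ {x w z y} → x ∈ S → w ∈ S → z ∈ S → y ∈ S → ¬ Unique (x ∷ w ∷ z ∷ y ∷ [])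
no-four-in-three {S = S} |S|≡3 {x} {w} {z} {y} x∈ w∈ z∈ y∈ u =
  1+n≰n (subst (4 ≤_) |S|≡3 (Unique-⊆⇒length≤ u four⊆S))
  where
  four⊆S : (x ∷ w ∷ z ∷ y ∷ []) ⊆ S
  four⊆S (here refl) = x∈
  four⊆S (there (here refl)) = w∈
  four⊆S (there (there (here refl))) = z∈
  four⊆S (there (there (there (here refl)))) = y∈

module _ {n} {g : BoolGraph n} (g-irrefl : ∀ u → g u u ≡ false) {S : List (Fin n)} (|S|≡3 : length S ≡ 3) where

  three-steps-within-2 : ∀ {x w z y} → InducedAdj g S x w → InducedAdj g S w z → InducedAdj g S z y →
                         Within (InducedAdj g S) x y 2
  three-steps-within-2 {x} {w} {z} {y} xw@(axw , x∈ , w∈) (awz , _ , z∈) zy@(azy , _ , y∈)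
    with x ≟ z | x ≟ y | w ≟ y
  ... | yes refl | _ | _ = Within-edge zy
  ... | no _ | yes refl | _ = Within-refl
  ... | no _ | no _ | yes refl = Within-edge xw
  ... | no x≢z | no x≢y | no w≢y = ⊥-elim (no-four-in-three |S|≡3 x∈ w∈ z∈ y∈
          ((irrefl axw ∷ x≢z ∷ x≢y ∷ []) ∷ (irrefl awz ∷ w≢y ∷ []) ∷ (irrefl azy ∷ []) ∷ [] ∷ []))
    where
    irrefl : ∀ {a b} → Adj g a b → a ≢ b
    irrefl = Adj-irrefl g g-irrefl

  Walk⇒within-2 : ∀ {x y ℓ} → Walk (InducedAdj g S) x y ℓ → Within (InducedAdj g S) x y 2
  Walk⇒within-2 here = Within-refl
  Walk⇒within-2 (step e rest) with Walk⇒within-2 rest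
  ... | .0 , _ , here = Within-edge e
  ... | .1 , _ , step e₂ here = 2 , ≤-refl , step e (step e₂ here)
  ... | .2 , _ , step e₂ (step e₃ here) = three-steps-within-2 e e₂ e₃
  ... | _ , s≤s (s≤s ()) , step _ (step _ (step _ _))

segment₃-within-2 : ∀ {n} {g : BoolGraph n} → (∀ u → g u u ≡ false) →
                    ∀ {S} → Segment g 3 S → ∀ {x y} → x ∈ S → y ∈ S → Within (Adj g) x y 2
segment₃-within-2 g-irrefl (|S|≡3 , _ , connected) x∈ y∈ =
  Within-map proj₁ (Walk⇒within-2 g-irrefl |S|≡3 (proj₂ (connected x∈ y∈)))

path₃-segment : ∀ {n} {g : BoolGraph n} → (∀ u v → g u v ≡ g v u) → (∀ u → g u u ≡ false) →
                ∀ {a b c} → Adj g a b → Adj g b c → a ≢ c → Segment g 3 (a ∷ b ∷ c ∷ [])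
path₃-segment {g = g} g-sym g-irrefl {a} {b} {c} ab bc a≢c = refl , unique , connected
  where
  S : List (Fin _)
  S = a ∷ b ∷ c ∷ []
  unique : Unique S
  unique = (Adj-irrefl g g-irrefl ab ∷ a≢c ∷ []) ∷ (Adj-irrefl g g-irrefl bc ∷ []) ∷ [] ∷ []
  induced-sym : Symmetric (InducedAdj g S)
  induced-sym (e , x∈ , y∈) = Adj-sym g g-sym e , y∈ , x∈
  toMiddle : ∀ {x} → x ∈ S → ∃ λ ℓ → Walk (InducedAdj g S) x b ℓ
  toMiddle (here refl) = 1 , step (ab , here refl , there (here refl)) here
  toMiddle (there (here refl)) = 0 , here
  toMiddle (there (there (here refl))) = 1 , step (induced-sym (bc , there (here refl) , there (there (here refl)))) here
  connected : InducedConnected g S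
  connected x∈ y∈ =
    let ℓ₁ , p = toMiddle x∈
        ℓ₂ , q = toMiddle y∈
    in ℓ₁ + ℓ₂ , Walk-++ p (Walk-reverse induced-sym q)

Universal : ∀ {n} → BoolGraph n → Fin n → Set
Universal g w = ∀ v → Within (Adj g) w v 1

universal⊎∈segment₃ : ∀ {n} {g : BoolGraph n} → (∀ u v → g u v ≡ g v u) → (∀ u → g u u ≡ false) →
                      Connected g → ∀ w → Universal g w ⊎ ∃ λ S → Segment g 3 S × w ∈ S
universal⊎∈segment₃ {g = g} g-sym g-irrefl connected w
  with Finₚ.any? (λ v → ¬? (within? (Adj? g) 1 w v))
... | no none = inj₁ λ v → decidable-stable (within? (Adj? g) 1 w v) (λ far → none (v , far))
... | yes (v , far) = inj₂ (segment-on (proj₂ (connected w v)))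
  where
  v-outside : ∀ {x} → Adj g w x → ¬ (v ≡ w ⊎ v ≡ x)
  v-outside wx (inj₁ refl) = far Within-refl
  v-outside wx (inj₂ refl) = far (Within-edge wx)
  segment-on : ∀ {ℓ} → Walk (Adj g) w v ℓ → ∃ λ S → Segment g 3 S × w ∈ S
  segment-on here = contradiction Within-refl far
  segment-on (step {w = x} wx rest)
    with Walk-exit (λ z → z ≡ w ⊎ z ≡ x) (λ z → (z ≟ w) ⊎-dec (z ≟ x)) (inj₂ refl) (v-outside wx) rest
  ... | _ , b , inj₁ refl , b-outside , wb =
          x ∷ w ∷ b ∷ [] , path₃-segment g-sym g-irrefl (Adj-sym g g-sym wx) wb (b-outside ∘ inj₂ ∘ sym) ,
          there (here refl)
  ... | _ , b , inj₂ refl , b-outside , xb =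
          w ∷ x ∷ b ∷ [] , path₃-segment g-sym g-irrefl wx xb (b-outside ∘ inj₁ ∘ sym) , here refl

-- The tree built by Algorithm 1

-- the divisor in treeParent: a non-root node has β δ − 1 children
innerArity : ℕ → ℕ → ℕ
innerArity β δ = suc (β * δ ∸ 2)

treeParent-cases : ∀ β δ j → (j ≤ β * δ × treeParent β δ j ≡ 0)
                           ⊎ (β * δ < j × treeParent β δ j ≡ suc ((j ∸ β * δ ∸ 1) / innerArity β δ))
treeParent-cases β δ j with j ≤ᵇ β * δ in eq
... | true = inj₁ (≤ᵇ⇒≤ j (β * δ) (subst T (sym eq) tt) , refl)
... | false = inj₂ (≰⇒> (λ j≤ → subst T eq (≤⇒≤ᵇ j≤)) , refl)

treeParent-1 : ∀ β δ → 1 ≤ β * δ → treeParent β δ 1 ≡ 0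
treeParent-1 β δ 1≤βδ with treeParent-cases β δ 1
... | inj₁ (_ , eq) = eq
... | inj₂ (βδ<1 , _) = contradiction 1≤βδ (<⇒≱ βδ<1)

suc-∸-∸1< : ∀ {m i} → 1 ≤ m → m ≤ i → suc i ∸ m ∸ 1 < i
suc-∸-∸1< {suc m} {suc i} _ _ = s≤s (∸-monoˡ-≤ 1 (m∸n≤m (suc i) m))

treeParent-< : ∀ β δ → 1 ≤ β * δ → ∀ i → treeParent β δ (suc i) < suc i
treeParent-< β δ 1≤βδ i with treeParent-cases β δ (suc i)
... | inj₁ (_ , eq) = subst (_< suc i) (sym eq) (s≤s z≤n)
... | inj₂ (βδ<1+i , eq) = subst (_< suc i) (sym eq)
        (s≤s (≤-trans (s≤s (m/n≤m _ (innerArity β δ))) (suc-∸-∸1< 1≤βδ (≤-pred βδ<1+i))))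

treeParent-≤ : ∀ β δ h i → suc i ≤ innerArity β δ ^ suc h → treeParent β δ (suc i) ≤ innerArity β δ ^ h
treeParent-≤ β δ h i 1+i≤ with treeParent-cases β δ (suc i)
... | inj₁ (_ , eq) = subst (_≤ _) (sym eq) z≤n
... | inj₂ (_ , eq) = subst (_≤ _) (sym eq) (m<n*o⇒m/o<n (begin-strict
        suc i ∸ β * δ ∸ 1                    ≤⟨ ∸-monoˡ-≤ 1 (m∸n≤m (suc i) (β * δ)) ⟩
        i                                    <⟨ 1+i≤ ⟩
        innerArity β δ ^ suc h               ≡⟨ *-comm (innerArity β δ) _ ⟩
        innerArity β δ ^ h * innerArity β δ  ∎))
  where open ≤-Reasoning

suc≤innerArity₃ : ∀ δ → 1 ≤ δ → suc δ ≤ innerArity 3 δ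
suc≤innerArity₃ δ 1≤δ = s≤s (m+n≤o⇒m≤o∸n δ (+-monoʳ-≤ δ (+-mono-≤ 1≤δ (≤-trans 1≤δ (m≤m+n δ 0)))))

Disjoint-sym : ∀ {n} → Symmetric (Disjoint {n})
Disjoint-sym disjoint v∈B v∈A = disjoint v∈A v∈B

shared-vertex⇒same-position : ∀ {n} {T : List (List (Fin n))} → AllPairs Disjoint T →
                              ∀ {p q A B x} → At T p A → At T q B → x ∈ A → x ∈ B → p ≡ q
shared-vertex⇒same-position _ at0 at0 _ _ = refl
shared-vertex⇒same-position (d ∷ _) at0 (atS B-at) x∈A x∈B = contradiction x∈B (All-At d B-at x∈A)
shared-vertex⇒same-position (d ∷ _) (atS A-at) at0 x∈A x∈B = contradiction x∈A (All-At d A-at x∈B)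
shared-vertex⇒same-position (_ ∷ ds) (atS A-at) (atS B-at) x∈A x∈B =
  cong suc (shared-vertex⇒same-position ds A-at B-at x∈A x∈B)

<∸1⇒suc< : ∀ {i} m → i < m ∸ 1 → suc i < m
<∸1⇒suc< (suc m) i< = s≤s i<

module TreeEdges {n β δ} (1≤βδ : 1 ≤ β * δ) {M : List (Edge n)} {T : List (List (Fin n))}
  (|M|≡ : length M ≡ length T ∸ 1)
  (ends : ∀ i e C P → At M i e → At T (suc i) C → At T (treeParent β δ (suc i)) P →
          proj₁ e ∈ C × proj₂ e ∈ P) where

  parent-at : ∀ {i C} → At T (suc i) C → ∃ λ P → At T (treeParent β δ (suc i)) P
  parent-at {i} C-at = <⇒At T (<-trans (treeParent-< β δ 1≤βδ i) (At⇒< C-at))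

  edge-at : ∀ {i C} → At T (suc i) C →
            ∃₂ λ e P → At M i e × At T (treeParent β δ (suc i)) P × proj₁ e ∈ C × proj₂ e ∈ P
  edge-at {i} {C} C-at =
    let e , e-at = <⇒At M (subst (i <_) (sym |M|≡) (∸-monoˡ-< (At⇒< C-at) (s≤s z≤n)))
        P , P-at = parent-at C-at
    in e , P , e-at , P-at , ends i e C P e-at C-at P-at

  endpoints-at : ∀ {i e} → At M i e →
                 ∃₂ λ C P → At T (suc i) C × At T (treeParent β δ (suc i)) P × proj₁ e ∈ C × proj₂ e ∈ P
  endpoints-at {i} {e} e-at =
    let C , C-at = <⇒At T (<∸1⇒suc< (length T) (subst (i <_) |M|≡ (At⇒< e-at)))
        P , P-at = parent-at C-at
    in C , P , C-at , P-at , ends i e C P e-at C-at P-at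

  edges-distinct : AllPairs Disjoint T → AllPairs (λ e f → ¬ SameEdge e f) M
  edges-distinct disjoint = AllPairs-fromAt M distinct
    where
    distinct : ∀ {i j e f} → i < j → At M i e → At M j f → ¬ SameEdge e f
    distinct {i} i<j e-at f-at e≈f with endpoints-at e-at | endpoints-at f-at | e≈f
    ... | _ , _ , C-at , _ , e₁∈ , _ | _ , _ , C′-at , _ , f₁∈ , _ | inj₁ refl =
          <-irrefl (suc-injective (shared-vertex⇒same-position disjoint C-at C′-at e₁∈ f₁∈)) i<j
    ... | _ , _ , _ , P-at , _ , e₂∈ | _ , _ , C′-at , _ , f₁∈ , _ | inj₂ refl =
          <-asym (subst (_< suc i) (shared-vertex⇒same-position disjoint P-at C′-at e₂∈ f₁∈)
                        (treeParent-< β δ 1≤βδ i))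
                 (s≤s i<j)

  module Radius {g : BoolGraph n} (g-irrefl : ∀ u → g u u ≡ false) (segments : All (Segment g 3) T) where

    H : Fin n → Fin n → Set
    H = Adj (augment g M)

    segment-within-2 : ∀ {p S} → At T p S → ∀ {x y} → x ∈ S → y ∈ S → Within H x y 2
    segment-within-2 S-at x∈ y∈ =
      Within-augment g M (segment₃-within-2 g-irrefl (All-At segments S-at) x∈ y∈)

    via-parent : ∀ {i S x z ℓ} → At T (suc i) S → x ∈ S →
                 (∀ {P y} → At T (treeParent β δ (suc i)) P → y ∈ P → Within H y z ℓ) →
                 Within H x z (2 + (1 + ℓ))
    via-parent S-at x∈ onward =
      let e , P , e-at , P-at , e₁∈ , e₂∈ = edge-at S-at
      in Within-trans (segment-within-2 S-at x∈ e₁∈)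
           (Within-trans (Within-edge (∈⇒Adj-augment g M (At⇒∈ e-at))) (onward P-at e₂∈))

    near-root : ∀ h {p S T₀} → At T p S → p ≤ innerArity β δ ^ h → At T 0 T₀ →
                ∀ {x y} → x ∈ S → y ∈ T₀ → Within H x y (3 * h + 5)
    near-root h {zero} S-at _ T₀-at x∈ y∈ =
      Within-mono (≤-trans (s≤s (s≤s z≤n)) (m≤n+m 5 (3 * h)))
        (segment-within-2 T₀-at (subst (_ ∈_) (At-functional S-at T₀-at) x∈) y∈)
    near-root zero {suc zero} S-at _ T₀-at x∈ y∈ = via-parent S-at x∈ λ P-at y′∈ →
      let P-at-root = subst (λ q → At T q _) (treeParent-1 β δ 1≤βδ) P-at
      in segment-within-2 T₀-at (subst (_ ∈_) (At-functional P-at-root T₀-at) y′∈) y∈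
    near-root zero {suc (suc _)} _ (s≤s ()) _ _ _
    near-root (suc h) {suc i} S-at p≤ T₀-at x∈ y∈ =
      subst (Within H _ _) (cong (_+ 5) (sym (*-suc 3 h))) (via-parent S-at x∈ λ P-at y′∈ →
        near-root h P-at (treeParent-≤ β δ h i p≤) T₀-at y′∈ y∈)

-- Farthest-first selection

headOr : ∀ {A : Set} → A → List A → A
headOr d [] = d
headOr d (x ∷ _) = x

segment-headOr-∈ : ∀ {n} {g : BoolGraph n} {β} d {S} → Segment g (suc β) S → headOr d S ∈ S
segment-headOr-∈ d {[]} (() , _)
segment-headOr-∈ d {x ∷ _} _ = here refl

SetWithin? : ∀ {n} (g : BoolGraph n) d A B → Dec (SetWithin g A B d)
SetWithin? g d A B = map′ from to (Any.any? (λ u → Any.any? (λ v → within? (Adj? g) d u v) B) A)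
  where
  from : Any (λ u → Any (λ v → Within (Adj g) u v d) B) A → SetWithin g A B d
  from near = let u , u∈ , near-u = find near
                  v , v∈ , uv = find near-u
              in u , v , u∈ , v∈ , uv
  to : SetWithin g A B d → Any (λ u → Any (λ v → Within (Adj g) u v d) B) A
  to (u , v , u∈ , v∈ , uv) = lose u∈ (lose v∈ uv)

∈-concat-take⇒∈-concat : ∀ {A : Set} (xss : List (List A)) j {x} → x ∈ concat (take j xss) → x ∈ concat xss
∈-concat-take⇒∈-concat xss j x∈ =
  let xs , x∈xs , xs∈ = ∈-concat⁻′ (take j xss) x∈ in ∈-concat⁺′ x∈xs (∈take⇒∈ xss j xs∈)

module FarthestFirstCover {n} {g : BoolGraph n} {𝒞 X : List (List (Fin n))}
  (segments : All (Segment g 3) 𝒞) (X⊆𝒞 : All (_∈ 𝒞) X) (farthest : FarthestFirst g 𝒞 X)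
  {d : ℕ} {C : List (Fin n)} (C∈𝒞 : C ∈ 𝒞) (C-far : ¬ SetWithin g C (concat X) d) (x₀ : Fin n) where

  Far : Fin n → Fin n → Set
  Far x y = ¬ Within (Adj g) x y d

  -- x₀ is only the default of headOr on [], which segments never are
  rep : List (Fin n) → Fin n
  rep = headOr x₀

  rep-∈ : ∀ {S} → S ∈ 𝒞 → rep S ∈ S
  rep-∈ S∈𝒞 = segment-headOr-∈ x₀ (All.lookup segments S∈𝒞)

  C∉X : C ∉ X
  C∉X C∈X = C-far (rep C , rep C , rep-∈ C∈𝒞 , ∈-concat⁺′ (rep-∈ C∈𝒞) C∈X , Within-refl)

  C∷X-unique : Unique X → Unique (C ∷ X)
  C∷X-unique X-unique = All.tabulate (λ S∈X C≡S → C∉X (subst (_∈ X) (sym C≡S) S∈X)) ∷ X-unique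

  C∷X⊆𝒞 : (C ∷ X) ⊆ 𝒞
  C∷X⊆𝒞 (here refl) = C∈𝒞
  C∷X⊆𝒞 (there S∈X) = All.lookup X⊆𝒞 S∈X

  rep-C-far : All (Far (rep C)) (map rep X)
  rep-C-far = All.map⁺ (All.tabulate λ {S} S∈X near →
    C-far (rep C , rep S , rep-∈ C∈𝒞 , ∈-concat⁺′ (rep-∈ (All.lookup X⊆𝒞 S∈X)) S∈X , near))

  reps-spread : Symmetric (Adj g) → AllPairs Far (map rep X)
  reps-spread G-sym = AllPairs-fromAt (map rep X) spread
    where
    spread : ∀ {i j x y} → i < j → At (map rep X) i x → At (map rep X) j y → Far x y
    spread {i} {j} i<j at-i at-j near with At-map⁻ rep at-i | At-map⁻ rep at-j
    ... | Sᵢ , Sᵢ-at , refl | Sⱼ , Sⱼ-at , refl =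
      let Sⱼ-near = rep Sⱼ , rep Sᵢ , rep-∈ (All-At X⊆𝒞 Sⱼ-at) ,
                    ∈-concat⁺′ (rep-∈ (All-At X⊆𝒞 Sᵢ-at)) (At⇒∈take Sᵢ-at i<j) , Within-sym G-sym near
          c , x , c∈ , x∈ , cx = farthest j Sⱼ Sⱼ-at C C∈𝒞 (C∉X ∘ ∈take⇒∈ X j) d Sⱼ-near
      in C-far (c , x , c∈ , ∈-concat-take⇒∈-concat X j x∈ , cx)

farthestFirst-covers : ∀ {n} {g : BoolGraph n} → (∀ u v → g u v ≡ g v u) →
                       ∀ {𝒞 X k} → All (Segment g 3) 𝒞 → All (_∈ 𝒞) X → Unique X →
                       length X ≡ suc k ⊓ length 𝒞 → FarthestFirst g 𝒞 X →
                       ∀ {M D} → length M ≤ k → DiamLE (augment g M) D →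
                       ∀ {C} → C ∈ 𝒞 → SetWithin g C (concat X) (D + D)
farthestFirst-covers g-sym segments _ _ _ _ _ _ {[]} C∈𝒞 =
  contradiction (proj₁ (All.lookup segments C∈𝒞)) λ ()
farthestFirst-covers {g = g} g-sym {𝒞} {X} {k} segments X⊆𝒞 X-unique |X|≡ farthest {M} {D} |M|≤k diam
                     {C@(x₀ ∷ _)} C∈𝒞
  with SetWithin? g (D + D) C (concat X)
... | yes near = near
... | no far = contradiction (≤-trans (subst (_≤ suc (length M)) |reps|≡ reps-bound) (s≤s |M|≤k)) 1+n≰n
  where
  open FarthestFirstCover segments X⊆𝒞 farthest C∈𝒞 far x₀
  |X|≡1+k : length X ≡ suc k
  |X|≡1+k with ⊓-sel (suc k) (length 𝒞)
  ... | inj₁ eq = trans |X|≡ eq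
  ... | inj₂ eq = contradiction (Unique-⊆⇒length≤ (C∷X-unique X-unique) C∷X⊆𝒞) (<-irrefl (trans |X|≡ eq))
  |reps|≡ : length (rep C ∷ map rep X) ≡ suc (suc k)
  |reps|≡ = cong suc (trans (length-map rep X) |X|≡1+k)
  reps-bound : length (rep C ∷ map rep X) ≤ suc (length M)
  reps-bound = farPoints-length≤ g g-sym {M} diam (rep-C-far ∷ reps-spread (Adj-sym g g-sym))

twice-radius≤ : ∀ t D → 1 ≤ D → let ρ = 2 + (2 + (D + D)) + (3 * t + 5) in ρ + ρ ≤ 28 * suc t * D
twice-radius≤ t (suc d) _ = subst (ρ + ρ ≤_) (identity t d) (m≤m+n (ρ + ρ) _)
  where
  ρ : ℕ
  ρ = 2 + (2 + (suc d + suc d)) + (3 * t + 5)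
  identity : ∀ t d → (2 + (2 + (suc d + suc d)) + (3 * t + 5)) + (2 + (2 + (suc d + suc d)) + (3 * t + 5))
                     + (28 * t * d + 22 * t + 24 * d + 6) ≡ 28 * suc t * suc d
  identity = solve-∀

module Alg1Analysis {n} {g : BoolGraph n} (g-sym : ∀ u v → g u v ≡ g v u) (g-irrefl : ∀ u → g u u ≡ false)
  (connected : Connected g) {k δ} (1≤δ : 1 ≤ δ) {𝒞 X T : List (List (Fin n))} {M : List (Edge n)}
  (segments : All (Segment g 3) 𝒞) (disjoint : AllPairs Disjoint 𝒞)
  (maximal : ∀ S → Segment g 3 S → Any (λ C → ∃ λ v → v ∈ S × v ∈ C) 𝒞)
  (X⊆𝒞 : All (_∈ 𝒞) X) (X-unique : Unique X) (|X|≡ : length X ≡ suc k ⊓ length 𝒞)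
  (farthest : FarthestFirst g 𝒞 X) (T↭X : T ↭ X) (|M|≡ : length M ≡ length X ∸ 1)
  (non-edges : All (NonEdge g) M)
  (ends : ∀ i e C P → At M i e → At T (suc i) C → At T (treeParent 3 δ (suc i)) P →
          proj₁ e ∈ C × proj₂ e ∈ P)
  (incident≤ : ∀ v → incident M v ≤ δ) where

  1≤3δ : 1 ≤ 3 * δ
  1≤3δ = ≤-trans 1≤δ (m≤m+n δ _)

  X↭T : X ↭ T
  X↭T = ↭-sym T↭X

  T-segments : All (Segment g 3) T
  T-segments = All-resp-↭ X↭T (All.map (All.lookup segments) X⊆𝒞)

  T-disjoint : AllPairs Disjoint T
  T-disjoint = Permutationₛ.AllPairs-resp-↭ (setoid _) Disjoint-sym (resp₂ Disjoint) (↭⇒↭ₛ X↭T)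
                 (AllPairs-⊆ Disjoint-sym disjoint X-unique X⊆𝒞)

  |T|≡|X| : length T ≡ length X
  |T|≡|X| = ↭-length T↭X

  |X|≤1+k : length X ≤ suc k
  |X|≤1+k = subst (_≤ suc k) (sym |X|≡) (m⊓n≤m (suc k) (length 𝒞))

  open TreeEdges {β = 3} {δ} 1≤3δ (trans |M|≡ (cong (_∸ 1) (sym |T|≡|X|))) ends
  open Radius g-irrefl T-segments

  feasible : Feasible g k δ M
  feasible = subst (_≤ k) (sym |M|≡) (∸-monoˡ-≤ 1 |X|≤1+k) , non-edges , edges-distinct T-disjoint ,
             λ v → ≤-trans (deg-augment≤ g M (All.map proj₁ non-edges) v) (+-monoʳ-≤ (deg g v) (incident≤ v))

  position≤ : ∀ {t} → k ≤ suc δ ^ t → ∀ {p S} → At T p S → p ≤ innerArity 3 δ ^ t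
  position≤ {t} k≤ S-at = ≤-trans (≤-pred (≤-trans (At⇒< S-at) (subst (_≤ suc k) (sym |T|≡|X|) |X|≤1+k)))
                                  (≤-trans k≤ (^-monoˡ-≤ t (suc≤innerArity₃ δ 1≤δ)))

  module _ {M′ D} (|M′|≤k : length M′ ≤ k) (diam : DiamLE (augment g M′) D) where

    NearTree : Fin n → Set
    NearTree w = ∃₂ λ p S → ∃ λ z → At T p S × z ∈ S × Within (Adj g) w z (2 + (2 + (D + D)))

    universal⊎near-tree : ∀ w → Universal g w ⊎ NearTree w
    universal⊎near-tree w with universal⊎∈segment₃ g-sym g-irrefl connected w
    ... | inj₁ universal = inj₁ universal
    ... | inj₂ (S , S-segment , w∈S) =
      let C , C∈𝒞 , z , z∈S , z∈C = find (maximal S S-segment)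
          a , b , a∈C , b∈X , ab = farthestFirst-covers g-sym segments X⊆𝒞 X-unique |X|≡ farthest
                                     {M′} |M′|≤k diam C∈𝒞
          B , b∈B , B∈X = ∈-concat⁻′ X b∈X
          p , B-at = ∈⇒At (∈-resp-↭ X↭T B∈X)
      in inj₂ (p , B , b , B-at , b∈B ,
               Within-trans (segment₃-within-2 g-irrefl S-segment w∈S z∈S)
                 (Within-trans (segment₃-within-2 g-irrefl (All.lookup segments C∈𝒞) z∈C a∈C) ab))

    H-sym : Symmetric H
    H-sym = Adj-sym (augment g M) (augment-sym M g-sym)

    near-tree⇒near-root : ∀ {t} → k ≤ suc δ ^ t → ∀ {w T₀ r} → NearTree w → At T 0 T₀ → r ∈ T₀ →
                          Within H w r (2 + (2 + (D + D)) + (3 * t + 5))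
    near-tree⇒near-root {t} k≤ (p , S , z , S-at , z∈S , wz) T₀-at r∈T₀ =
      Within-trans (Within-augment g M wz)
                   (near-root t S-at (position≤ {t} k≤ S-at) T₀-at z∈S r∈T₀)

    bound-positive : ∀ t {u v} → u ≢ v → 1 ≤ 28 * suc t * D
    bound-positive t {u} {v} u≢v = ≤-trans (Within-positive u≢v (diam u v)) (m≤n*m D (28 * suc t))

    diameter≤ : ∀ t → k ≤ suc δ ^ t → DiamLE (augment g M) (28 * suc t * D)
    diameter≤ t k≤ u v with u ≟ v
    ... | yes refl = Within-refl
    ... | no u≢v with universal⊎near-tree u | universal⊎near-tree v
    ...   | inj₁ u-universal | _ =
            Within-mono (bound-positive t u≢v) (Within-augment g M (u-universal v))
    ...   | inj₂ _ | inj₁ v-universal =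
            Within-mono (bound-positive t u≢v) (Within-sym H-sym (Within-augment g M (v-universal u)))
    ...   | inj₂ u-near@(_ , _ , _ , S-at , _) | inj₂ v-near =
            let T₀ , T₀-at = <⇒At T (≤-trans (s≤s z≤n) (At⇒< S-at))
                r∈T₀ = segment-headOr-∈ u (All-At T-segments T₀-at)
            in Within-mono (twice-radius≤ t D (Within-positive u≢v (diam u v)))
                 (Within-trans (near-tree⇒near-root {t} k≤ u-near T₀-at r∈T₀)
                               (Within-sym H-sym (near-tree⇒near-root {t} k≤ v-near T₀-at r∈T₀)))

corollary2 : ∃ λ (c : ℕ) →
    ∀ (n : ℕ) (g : BoolGraph n) →
    (∀ u v → g u v ≡ g v u) → (∀ u → g u u ≡ false) → Connected g →
    ∀ (k δ : ℕ) → 1 ≤ k → 1 ≤ δ →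
    ∀ (M : List (Edge n)) → Alg1Run g 3 k δ M →
    Feasible g k δ M
    × (∀ (M' : List (Edge n)) → Feasible g k δ M' →
        ∀ (D t : ℕ) → k ≤ suc δ ^ t → DiamLE (augment g M') D →
        DiamLE (augment g M) (c * suc t * D))
corollary2 = 28 , λ n g g-sym g-irrefl connected k δ _ 1≤δ M
  (𝒞 , X , (segments , disjoint , maximal) , X⊆𝒞 , X-unique , |X|≡ , farthest ,
   (T , T↭X , |M|≡ , non-edges , ends , incident≤)) →
  let open Alg1Analysis g-sym g-irrefl connected 1≤δ segments disjoint maximal
                        X⊆𝒞 X-unique |X|≡ farthest T↭X |M|≡ non-edges ends incident≤
  in feasible , λ M′ (|M′|≤k , _) D t k≤ diam → diameter≤ {M′} |M′|≤k diam t k≤
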